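{- On the set of prime types, the relation $S_c$ defined by $\Phi\,S_c\,\Psi$ iff $\Phi\,S_T\,\Psi$ is a function (every prime type $\Phi$ has exactly one prime type $\Psi$ with $\Phi\,S_c\,\Psi$, namely $\Psi=(\{\varphi:\bigcirc\varphi\in\Phi^-\},\{\varphi:\bigcirc\varphi\in\Phi^+\})$), and it is forward-confluent: if $\Phi^+\subseteq\Psi^+$ then $S_c(\Phi)^+\subseteq S_c(\Psi)^+$.
   Context: $\mathcal L_\lozenge$ is the language $\bot\mid p\mid\varphi\wedge\psi\mid\varphi\vee\psi\mid\varphi\to\psi\mid\bigcirc\varphi\mid\lozenge\varphi$. ${\sf ITL}^0_\lozenge$ is the least set of $\mathcal L_\lozenge$-formulas containing all intuitionistic propositional tautologies and all instances of $\neg\bigcirc\bot$; $\bigcirc\varphi\wedge\bigcirc\psi\to\bigcirc(\varphi\wedge\psi)$; $\bigcirc(\varphi\vee\psi)\to\bigcirc\varphi\vee\bigcirc\psi$; $\bigcirc(\varphi\to\psi)\to(\bigcirc\varphi\to\bigcirc\psi)$; $\varphi\vee\bigcirc\lozenge\varphi\to\lozenge\varphi$; closed under modus ponens, from $\varphi$ infer $\bigcirc\varphi$, from $\varphi\to\psi$ infer $\lozenge\varphi\to\lozenge\psi$, from $\bigcirc\varphi\to\varphi$ infer $\lozenge\varphi\to\varphi$. $\Gamma\vdash\Delta$ means $\bigwedge\Gamma'\to\bigvee\Delta'\in{\sf ITL}^0_\lozenge$ for some finite $\Gamma'\subseteq\Gamma,\Delta'\subseteq\Delta$ (empty conjunction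 $\top$, empty disjunction $\bot$). A prime type is a pair $\Phi=(\Phi^-,\Phi^+)$ with $\Phi^-\cup\Phi^+=\mathcal L_\lozenge$ and $\Phi^+\not\vdash\Phi^-$. For pairs, $\Phi\,S_T\,\Psi$ iff for all $\varphi$: $\bigcirc\varphi\in\Phi^+\Rightarrow\varphi\in\Psi^+$; $\bigcirc\varphi\in\Phi^-\Rightarrow\varphi\in\Psi^-$; ($\lozenge\varphi\in\Phi^+$ and $\varphi\in\Phi^-$) $\Rightarrow\lozenge\varphi\in\Psi^+$; $\lozenge\varphi\in\Phi^-\Rightarrow\lozenge\varphi\in\Psi^-$. -}

module Defs where

open import Data.Nat using (ℕ)
open import Data.List using (List; []; _∷_; foldr)
open import Data.List.Relation.Unary.All using (All)
open import Data.Product using (Σ; ∃; _×_; _,_)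
open import Data.Sum using (_⊎_)
open import Relation.Nullary using (¬_)

infixr 6 _∧_
infixr 5 _∨_
infixr 4 _⇒_

data Fm : Set where
  ⊥′  : Fm
  var : ℕ → Fm
  _∧_ : Fm → Fm → Fm
  _∨_ : Fm → Fm → Fm
  _⇒_ : Fm → Fm → Fm
  ○   : Fm → Fm
  ◇   : Fm → Fm

¬′ : Fm → Fm
¬′ φ = φ ⇒ ⊥′

⊤′ : Fm
⊤′ = ⊥′ ⇒ ⊥′

-- The logic ITL⁰◇.  "All intuitionistic propositional tautologies" (substitution
-- instances in L◇) are generated by the standard Hilbert axioms of intuitionistic
-- propositional logic together with modus ponens (which ITL⁰◇ is closed under).
data ITL : Fm → Set where
  ax-K    : ∀ φ ψ → ITL (φ ⇒ ψ ⇒ φ)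
  ax-S    : ∀ φ ψ χ → ITL ((φ ⇒ ψ ⇒ χ) ⇒ (φ ⇒ ψ) ⇒ φ ⇒ χ)
  ax-∧I   : ∀ φ ψ → ITL (φ ⇒ ψ ⇒ φ ∧ ψ)
  ax-∧E₁  : ∀ φ ψ → ITL (φ ∧ ψ ⇒ φ)
  ax-∧E₂  : ∀ φ ψ → ITL (φ ∧ ψ ⇒ ψ)
  ax-∨I₁  : ∀ φ ψ → ITL (φ ⇒ φ ∨ ψ)
  ax-∨I₂  : ∀ φ ψ → ITL (ψ ⇒ φ ∨ ψ)
  ax-∨E   : ∀ φ ψ χ → ITL ((φ ⇒ χ) ⇒ (ψ ⇒ χ) ⇒ φ ∨ ψ ⇒ χ)
  ax-⊥E   : ∀ φ → ITL (⊥′ ⇒ φ)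
  ax-○⊥   : ITL (¬′ (○ ⊥′))
  ax-○∧   : ∀ φ ψ → ITL (○ φ ∧ ○ ψ ⇒ ○ (φ ∧ ψ))
  ax-○∨   : ∀ φ ψ → ITL (○ (φ ∨ ψ) ⇒ ○ φ ∨ ○ ψ)
  ax-○⇒   : ∀ φ ψ → ITL (○ (φ ⇒ ψ) ⇒ ○ φ ⇒ ○ ψ)
  ax-◇fix : ∀ φ → ITL (φ ∨ ○ (◇ φ) ⇒ ◇ φ)
  mp      : ∀ {φ ψ} → ITL (φ ⇒ ψ) → ITL φ → ITL ψ
  nec     : ∀ {φ} → ITL φ → ITL (○ φ)
  ◇mono   : ∀ {φ ψ} → ITL (φ ⇒ ψ) → ITL (◇ φ ⇒ ◇ ψ)
  ◇ind    : ∀ {φ} → ITL (○ φ ⇒ φ) → ITL (◇ φ ⇒ φ)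

FmSet : Set₁
FmSet = Fm → Set

_⊆_ : FmSet → FmSet → Set
A ⊆ B = ∀ φ → A φ → B φ

⋀ : List Fm → Fm
⋀ = foldr _∧_ ⊤′

⋁ : List Fm → Fm
⋁ = foldr _∨_ ⊥′

_⊢_ : FmSet → FmSet → Set
Γ ⊢ Δ = Σ (List Fm) λ Γ' → Σ (List Fm) λ Δ' →
          All Γ Γ' × All Δ Δ' × ITL (⋀ Γ' ⇒ ⋁ Δ')

record Pair : Set₁ where
  constructor ⟨_,_⟩
  field
    neg : FmSet
    pos : FmSet
open Pair public

IsPrimeType : Pair → Set
IsPrimeType Φ = (∀ φ → neg Φ φ ⊎ pos Φ φ) × ¬ (pos Φ ⊢ neg Φ)

S_T : Pair → Pair → Set
S_T Φ Ψ =
  (∀ φ → pos Φ (○ φ) → pos Ψ φ) ×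
  (∀ φ → neg Φ (○ φ) → neg Ψ φ) ×
  (∀ φ → pos Φ (◇ φ) → neg Φ φ → pos Ψ (◇ φ)) ×
  (∀ φ → neg Φ (◇ φ) → neg Ψ (◇ φ))

Sc : Pair → Pair
Sc Φ = ⟨ (λ φ → neg Φ (○ φ)) , (λ φ → pos Φ (○ φ)) ⟩

_≐_ : Pair → Pair → Set
Φ ≐ Ψ = (neg Φ ⊆ neg Ψ × neg Ψ ⊆ neg Φ) × (pos Φ ⊆ pos Ψ × pos Ψ ⊆ pos Φ)

-- S_c(Φ) is a prime type because ○ commutes with finite conjunctions and disjunctions
-- (using ¬○⊥), so a derivation S_c(Φ)⁺ ⊢ S_c(Φ)⁻ yields Φ⁺ ⊢ Φ⁻ by necessitation.
-- The ◇-clauses of S_T hold for it because ◇φ ↔ φ ∨ ○◇φ, the implication from left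
-- to right coming from the induction rule. Any S_T-successor Ψ contains S_c(Φ)
-- componentwise, and two prime types ordered this way coincide.
module Submission where

open import Defs
open import Data.Empty using (⊥; ⊥-elim)
open import Data.List using ([]; _∷_; map)
open import Data.List.Relation.Unary.All using ([]; _∷_)
open import Data.List.Relation.Unary.All.Properties using (map⁺)
open import Data.Product using (_×_; _,_; proj₁; proj₂)
open import Data.Sum using (_⊎_; inj₁; inj₂; [_,_]′)
open import Relation.Nullary using (¬_)

⇒-refl : ∀ φ → ITL (φ ⇒ φ)
⇒-refl φ = mp (mp (ax-S φ (φ ⇒ φ) φ) (ax-K φ (φ ⇒ φ))) (ax-K φ φ)

⇒-trans : ∀ {φ ψ χ} → ITL (φ ⇒ ψ) → ITL (ψ ⇒ χ) → ITL (φ ⇒ χ)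
⇒-trans {φ} {ψ} {χ} f g = mp (mp (ax-S φ ψ χ) (mp (ax-K (ψ ⇒ χ) φ) g)) f

∧-intro : ∀ {φ ψ χ} → ITL (φ ⇒ ψ) → ITL (φ ⇒ χ) → ITL (φ ⇒ ψ ∧ χ)
∧-intro {φ} {ψ} {χ} f g = mp (mp (ax-S φ χ (ψ ∧ χ)) (⇒-trans f (ax-∧I ψ χ))) g

∨-elim : ∀ {φ ψ χ} → ITL (φ ⇒ χ) → ITL (ψ ⇒ χ) → ITL (φ ∨ ψ ⇒ χ)
∨-elim {φ} {ψ} {χ} f g = mp (mp (ax-∨E φ ψ χ) f) g

∧-map : ∀ {φ ψ φ′ ψ′} → ITL (φ ⇒ φ′) → ITL (ψ ⇒ ψ′) → ITL (φ ∧ ψ ⇒ φ′ ∧ ψ′)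
∧-map {φ} {ψ} f g = ∧-intro (⇒-trans (ax-∧E₁ φ ψ) f) (⇒-trans (ax-∧E₂ φ ψ) g)

∨-map : ∀ {φ ψ φ′ ψ′} → ITL (φ ⇒ φ′) → ITL (ψ ⇒ ψ′) → ITL (φ ∨ ψ ⇒ φ′ ∨ ψ′)
∨-map {φ′ = φ′} {ψ′} f g = ∨-elim (⇒-trans f (ax-∨I₁ φ′ ψ′)) (⇒-trans g (ax-∨I₂ φ′ ψ′))

○-mono : ∀ {φ ψ} → ITL (φ ⇒ ψ) → ITL (○ φ ⇒ ○ ψ)
○-mono {φ} {ψ} f = mp (ax-○⇒ φ ψ) (nec f)

○-⋀ : ∀ Γ → ITL (⋀ (map ○ Γ) ⇒ ○ (⋀ Γ))
○-⋀ []      = mp (ax-K (○ ⊤′) ⊤′) (nec (⇒-refl ⊥′))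
○-⋀ (φ ∷ Γ) = ⇒-trans (∧-map (⇒-refl (○ φ)) (○-⋀ Γ)) (ax-○∧ φ (⋀ Γ))

○-⋁ : ∀ Δ → ITL (○ (⋁ Δ) ⇒ ⋁ (map ○ Δ))
○-⋁ []      = ax-○⊥
○-⋁ (φ ∷ Δ) = ⇒-trans (ax-○∨ φ (⋁ Δ)) (∨-map (⇒-refl (○ φ)) (○-⋁ Δ))

○-sequent : ∀ Γ Δ → ITL (⋀ Γ ⇒ ⋁ Δ) → ITL (⋀ (map ○ Γ) ⇒ ⋁ (map ○ Δ))
○-sequent Γ Δ f = ⇒-trans (○-⋀ Γ) (⇒-trans (○-mono f) (○-⋁ Δ))

◇-intro : ∀ φ → ITL (φ ⇒ ◇ φ)
◇-intro φ = ⇒-trans (ax-∨I₁ φ (○ (◇ φ))) (ax-◇fix φ)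

○◇⇒◇ : ∀ φ → ITL (○ (◇ φ) ⇒ ◇ φ)
○◇⇒◇ φ = ⇒-trans (ax-∨I₂ φ (○ (◇ φ))) (ax-◇fix φ)

-- φ ∨ ○◇φ is a ○-prefixpoint containing φ, so the induction rule bounds ◇φ by it.
◇-unfold : ∀ φ → ITL (◇ φ ⇒ φ ∨ ○ (◇ φ))
◇-unfold φ = ⇒-trans (◇mono (ax-∨I₁ φ (○ (◇ φ)))) (◇ind ○-prefixpoint)
  where
  ○-prefixpoint : ITL (○ (φ ∨ ○ (◇ φ)) ⇒ φ ∨ ○ (◇ φ))
  ○-prefixpoint = ⇒-trans (ax-○∨ φ (○ (◇ φ)))
    (∨-elim (⇒-trans (○-mono (◇-intro φ)) (ax-∨I₂ φ (○ (◇ φ))))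
            (⇒-trans (○-mono (○◇⇒◇ φ)) (ax-∨I₂ φ (○ (◇ φ)))))

single-premise : ∀ {φ ψ} → ITL (φ ⇒ ψ) → ITL (⋀ (φ ∷ []) ⇒ ψ)
single-premise {φ} = ⇒-trans (ax-∧E₁ φ ⊤′)

module PrimeType {Φ : Pair} (prime : IsPrimeType Φ) where

  private
    total = proj₁ prime
    consistent = proj₂ prime

  pos-neg-disjoint : ∀ {φ} → pos Φ φ → neg Φ φ → ⊥
  pos-neg-disjoint {φ} p n =
    consistent (φ ∷ [] , φ ∷ [] , p ∷ [] , n ∷ [] , single-premise (ax-∨I₁ φ ⊥′))

  pos-closed : ∀ {φ ψ} → ITL (φ ⇒ ψ) → pos Φ φ → pos Φ ψ
  pos-closed {φ} {ψ} f p = [ (λ n → ⊥-elim (refute n)) , (λ q → q) ]′ (total ψ)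
    where
    refute : neg Φ ψ → ⊥
    refute n = consistent (φ ∷ [] , ψ ∷ [] , p ∷ [] , n ∷ [] ,
                           single-premise (⇒-trans f (ax-∨I₁ ψ ⊥′)))

  neg-closed : ∀ {φ ψ} → ITL (φ ⇒ ψ) → neg Φ ψ → neg Φ φ
  neg-closed {φ} f n = [ (λ m → m) , (λ p → ⊥-elim (pos-neg-disjoint (pos-closed f p) n)) ]′ (total φ)

  pos-∨ : ∀ {φ ψ} → pos Φ (φ ∨ ψ) → pos Φ φ ⊎ pos Φ ψ
  pos-∨ {φ} {ψ} p with total φ | total ψ
  ... | inj₂ pφ | _      = inj₁ pφ
  ... | inj₁ _  | inj₂ pψ = inj₂ pψ
  ... | inj₁ nφ | inj₁ nψ = ⊥-elim (consistent ((φ ∨ ψ) ∷ [] , φ ∷ ψ ∷ [] , p ∷ [] , nφ ∷ nψ ∷ [] ,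
                              single-premise (∨-map (⇒-refl φ) (ax-∨I₁ ψ ⊥′))))

≐-sym : ∀ {Φ Ψ} → Φ ≐ Ψ → Ψ ≐ Φ
≐-sym ((n₁ , n₂) , (p₁ , p₂)) = (n₂ , n₁) , (p₂ , p₁)

-- Between prime types, inclusion of both components forces equality: each side is the
-- complement of the other.
⊆-prime⇒≐ : ∀ {Φ Ψ} → IsPrimeType Φ → IsPrimeType Ψ →
            neg Φ ⊆ neg Ψ → pos Φ ⊆ pos Ψ → Φ ≐ Ψ
⊆-prime⇒≐ {Φ} {Ψ} (totalΦ , _) primeΨ n⊆ p⊆ =
  (n⊆ , λ φ n → [ (λ m → m) , (λ p → ⊥-elim (pos-neg-disjoint (p⊆ φ p) n)) ]′ (totalΦ φ)) ,
  (p⊆ , λ φ p → [ (λ n → ⊥-elim (pos-neg-disjoint p (n⊆ φ n))) , (λ q → q) ]′ (totalΦ φ))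
  where open PrimeType primeΨ

Sc-consistent : ∀ Φ → ¬ (pos Φ ⊢ neg Φ) → ¬ (pos (Sc Φ) ⊢ neg (Sc Φ))
Sc-consistent Φ consistent (Γ , Δ , ○Γ⊆Φ⁺ , ○Δ⊆Φ⁻ , f) =
  consistent (map ○ Γ , map ○ Δ , map⁺ ○Γ⊆Φ⁺ , map⁺ ○Δ⊆Φ⁻ , ○-sequent Γ Δ f)

Sc-prime : ∀ {Φ} → IsPrimeType Φ → IsPrimeType (Sc Φ)
Sc-prime {Φ} (total , consistent) = (λ φ → total (○ φ)) , Sc-consistent Φ consistent

Sc-S_T : ∀ {Φ} → IsPrimeType Φ → S_T Φ (Sc Φ)
Sc-S_T {Φ} prime = (λ _ p → p) , (λ _ n → n) , ◇-step , ◇-persist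
  where
  open PrimeType prime

  ◇-step : ∀ φ → pos Φ (◇ φ) → neg Φ φ → pos Φ (○ (◇ φ))
  ◇-step φ p n = [ (λ pφ → ⊥-elim (pos-neg-disjoint pφ n)) , (λ q → q) ]′
                   (pos-∨ (pos-closed (◇-unfold φ) p))

  ◇-persist : ∀ φ → neg Φ (◇ φ) → neg Φ (○ (◇ φ))
  ◇-persist φ = neg-closed (○◇⇒◇ φ)

S_T-unique : ∀ {Φ Ψ} → IsPrimeType Φ → IsPrimeType Ψ → S_T Φ Ψ → Ψ ≐ Sc Φ
S_T-unique primeΦ primeΨ (○⁺ , ○⁻ , _ , _) = ≐-sym (⊆-prime⇒≐ (Sc-prime primeΦ) primeΨ ○⁻ ○⁺)

Sc-mono : ∀ {Φ Ψ} → pos Φ ⊆ pos Ψ → pos (Sc Φ) ⊆ pos (Sc Ψ)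
Sc-mono Φ⁺⊆Ψ⁺ φ = Φ⁺⊆Ψ⁺ (○ φ)

lemmaA2 : (∀ (Φ : Pair) → IsPrimeType Φ →
               IsPrimeType (Sc Φ) × S_T Φ (Sc Φ) ×
               (∀ (Ψ : Pair) → IsPrimeType Ψ → S_T Φ Ψ → Ψ ≐ Sc Φ))
            × (∀ (Φ Ψ : Pair) → IsPrimeType Φ → IsPrimeType Ψ →
               pos Φ ⊆ pos Ψ → pos (Sc Φ) ⊆ pos (Sc Ψ))
lemmaA2 =
  (λ Φ prime → Sc-prime prime , Sc-S_T prime , λ Ψ primeΨ → S_T-unique prime primeΨ) ,
  (λ Φ Ψ _ _ → Sc-mono {Φ} {Ψ})
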